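{- Let $n,k$ be integers with $3\leq k\leq n-1$ and let $G$ be a graph on $n$ vertices which is the $(1,2)$-step competition graph $C_{1,2}(T)$ of some $k$-hypertournament $T$ on $n$ vertices. If $G\neq K_{n-1}\cup K_{1}$, then the complement $G^{c}$ of $G$ does not contain $K_{1,3}$ as a subgraph.
   Context: Given integers $n\geq k>1$, a $k$-hypertournament on $n$ vertices is a pair $T=(V,A)$ where $|V|=n$ and $A$ is a set of $k$-tuples of distinct vertices (arcs) such that for every $k$-subset $S$ of $V$, $A$ contains exactly one of the $k!$ $k$-tuples whose entries are the elements of $S$. A path in $T$ is a sequence $v_1a_1v_2a_2\cdots a_{t-1}v_t$ of distinct vertices $v_1,\dots,v_t$ ($t\geq1$) and distinct arcs $a_1,\dots,a_{t-1}$ such that $v_i$ precedes $v_{i+1}$ in $a_i$; its length $l(\cdot)$ is the number of arcs, and it is an $(x,y)$-path if $v_1=x$, $v_t=y$. $C_{1,2}(T)$ is the graph on $V(T)$ in which $xy$ is an edge if and only if there exist a vertex $z\neq x,y$, an $(x,z)$-path $P$ and a $(y,z)$-path $Q$ such that: $y\notin V(P)$, $x\notin V(Q)$; either ($l(P)\leq 1$ and $l(Q)\leq 2$) or ($l(Q)\leq 1$ and $l(P)\leq 2$); and $P$, $Q$ are arc-disjoint. $G^c$ is the graph on $V(G)$ whose edges are the non-adjacent pairs of $G$. $K_{n-1}\cup K_1$ is the disjoint union of a complete graph on $n-1$ vertices and an isolated vertex. -}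

module Defs where

open import Data.Nat using (ℕ; zero; suc; _≤_)
open import Data.Fin using (Fin; inject₁; _<_) renaming (suc to fsuc)
open import Data.Fin.Subset using (Subset; ∣_∣) renaming (_∈_ to _∈ₛ_)
open import Data.Vec using (Vec; lookup; head; last)
open import Data.Vec.Membership.Propositional using (_∈_)
open import Data.Product using (Σ; ∃; ∃-syntax; _×_; _,_)
open import Data.Sum using (_⊎_)
open import Function.Bundles using (_⇔_)
open import Relation.Binary.PropositionalEquality using (_≡_; _≢_)
open import Relation.Nullary using (¬_)

Distinct : ∀ {A : Set} {m} → Vec A m → Set
Distinct {m = m} v = ∀ (i j : Fin m) → lookup v i ≡ lookup v j → i ≡ j

EntrySet : ∀ {n k} → Vec (Fin n) k → Subset n → Set
EntrySet t S = ∀ v → (v ∈ t) ⇔ (v ∈ₛ S)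

record HyperTournament (n k : ℕ) : Set₁ where
  field
    Arc          : Vec (Fin n) k → Set
    arc-distinct : ∀ t → Arc t → Distinct t
    arc-exists   : ∀ (S : Subset n) → ∣ S ∣ ≡ k → ∃[ t ] (Arc t × EntrySet t S)
    arc-unique   : ∀ (S : Subset n) → ∣ S ∣ ≡ k → ∀ t t' → Arc t → Arc t' →
                   EntrySet t S → EntrySet t' S → t ≡ t'

Precedes : ∀ {n k} → Fin n → Fin n → Vec (Fin n) k → Set
Precedes {k = k} x y a = ∃[ i ] ∃[ j ] (i < j × lookup a i ≡ x × lookup a j ≡ y)

-- a path v_1 a_1 v_2 ... a_{t-1} v_t with len = t - 1 arcs, from x to y
record Path {n k} (T : HyperTournament n k) (x y : Fin n) : Set where
  open HyperTournament T
  field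
    len       : ℕ
    verts     : Vec (Fin n) (suc len)
    arcs      : Vec (Vec (Fin n) k) len
    start     : head verts ≡ x
    end       : last verts ≡ y
    verts-dis : Distinct verts
    arcs-dis  : Distinct arcs
    arcs-in   : ∀ i → Arc (lookup arcs i)
    steps     : ∀ (i : Fin len) →
                Precedes (lookup verts (inject₁ i)) (lookup verts (fsuc i)) (lookup arcs i)

open Path public

l : ∀ {n k} {T : HyperTournament n k} {x y} → Path T x y → ℕ
l P = len P

_∈V_ : ∀ {n k} {T : HyperTournament n k} {x y} → Fin n → Path T x y → Set
v ∈V P = ∃[ i ] (lookup (verts P) i ≡ v)

ArcDisjoint : ∀ {n k} {T : HyperTournament n k} {x y x' y'} →
              Path T x y → Path T x' y' → Set
ArcDisjoint P Q = ∀ i j → lookup (arcs P) i ≢ lookup (arcs Q) j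

C₁₂ : ∀ {n k} → HyperTournament n k → Fin n → Fin n → Set
C₁₂ {n} T x y =
  ∃[ z ] (z ≢ x × z ≢ y ×
    Σ (Path T x z) λ P → Σ (Path T y z) λ Q →
      ¬ (y ∈V P) × ¬ (x ∈V Q) ×
      ((l P ≤ 1 × l Q ≤ 2) ⊎ (l Q ≤ 1 × l P ≤ 2)) ×
      ArcDisjoint P Q)

-- a graph on vertex set Fin n: a symmetric irreflexive adjacency relation
-- (we only need adjacency relations here)

IsKn-1∪K1 : ∀ {n} → (Fin n → Fin n → Set) → Set
IsKn-1∪K1 {n} G = ∃[ w ] ∀ x y → G x y ⇔ (x ≢ y × x ≢ w × y ≢ w)

Complement : ∀ {n} → (Fin n → Fin n → Set) → Fin n → Fin n → Set
Complement G x y = x ≢ y × ¬ G x y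

ContainsK13 : ∀ {n} → (Fin n → Fin n → Set) → Set
ContainsK13 H = ∃[ c ] ∃[ a ] ∃[ b ] ∃[ d ]
  (c ≢ a × c ≢ b × c ≢ d × a ≢ b × a ≢ d × b ≢ d ×
   H c a × H c b × H c d)

-- If c is non-adjacent to three vertices a, b, d of C₁₂(T), then c is a sink of T: c precedes
-- nothing in any arc. Indeed, if c precedes z in an arc α, pick y₁ ≠ y₂ among a, b, d other than
-- z, an arc β ⊇ {z, y₁, y₂} missing c and an arc γ ⊇ {y₁, y₂} missing z (they exist as 3 ≤ k ≤ n − 1).
-- If some yᵢ precedes z in β, then c →α z ←β yᵢ makes c adjacent to yᵢ; otherwise z precedes
-- both in β, and if yᵢ precedes yⱼ in γ then c →α z →β yⱼ ←γ yᵢ makes c adjacent to yᵢ.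
-- A sink starts no path of positive length, so it is isolated in C₁₂(T), while any two other
-- vertices x, y both precede c in arcs through {x, c} missing y and through {y, c} missing x,
-- so they are adjacent. Hence C₁₂(T) = K_{n-1} ∪ K_1.
module Submission where

open import Defs
open import Data.Nat using (ℕ; zero; suc; _+_; _∸_; _≤_; z≤n; s≤s)
import Data.Nat.Properties as ℕ
open import Data.Fin using (Fin; _≟_) renaming (zero to fzero; suc to fsuc)
import Data.Fin.Properties as Fin
open import Data.Fin.Subset using (Subset; ∣_∣; ⁅_⁆; _∪_; ∁; _⊆_; ⊥; inside; outside)
  renaming (_∈_ to _∈ₛ_)
open import Data.Fin.Subset.Properties
open import Data.List using (List; length) renaming ([] to []ₗ; _∷_ to _∷ₗ_)
open import Data.List.Membership.Propositional using () renaming (_∈_ to _∈ₗ_)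
open import Data.List.Relation.Unary.All as All using (All) renaming ([] to []ₐ; _∷_ to _∷ₐ_)
open import Data.List.Relation.Unary.Any as Any using ()
open import Data.Vec using (Vec; []; _∷_; lookup; head; here)
open import Data.Vec.Membership.Propositional using (_∈_; _∉_)
open import Data.Vec.Membership.Propositional.Properties using (∈-lookup)
import Data.Vec.Relation.Unary.All as VecAll
import Data.Vec.Relation.Unary.Any as VecAny
open import Data.Vec.Relation.Unary.Any.Properties using (lookup-index)
open import Data.Product using (∃-syntax; _×_; _,_)
open import Data.Sum using (_⊎_; inj₁; inj₂; [_,_]; swap)
open import Function using (_∘_; id)
open import Function.Bundles using (mk⇔; Equivalence)
open import Relation.Binary.Definitions using (tri<; tri≈; tri>)
open import Relation.Binary.PropositionalEquality using (_≡_; _≢_; refl; sym; trans; subst; cong; ≢-sym; module ≡-Reasoning)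
open import Relation.Nullary using (¬_; yes; no; contradiction)

private
  variable
    A : Set
    n k : ℕ

∣p∪q∣≤∣p∣+∣q∣ : (p q : Subset n) → ∣ p ∪ q ∣ ≤ ∣ p ∣ + ∣ q ∣
∣p∪q∣≤∣p∣+∣q∣ []            []            = z≤n
∣p∪q∣≤∣p∣+∣q∣ (outside ∷ p) (outside ∷ q) = ∣p∪q∣≤∣p∣+∣q∣ p q
∣p∪q∣≤∣p∣+∣q∣ (outside ∷ p) (inside ∷ q)  =
  ℕ.≤-trans (s≤s (∣p∪q∣≤∣p∣+∣q∣ p q)) (ℕ.≤-reflexive (sym (ℕ.+-suc ∣ p ∣ ∣ q ∣)))
∣p∪q∣≤∣p∣+∣q∣ (inside ∷ p)  (s ∷ q)       =
  s≤s (ℕ.≤-trans (∣p∪q∣≤∣p∣+∣q∣ p q) (ℕ.+-monoʳ-≤ ∣ p ∣ (∣p∣≤∣x∷p∣ s q)))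

subset-of-size-between : (m U : Subset n) (k : ℕ) → m ⊆ U → ∣ m ∣ ≤ k → k ≤ ∣ U ∣ →
                         ∃[ S ] (∣ S ∣ ≡ k × m ⊆ S × S ⊆ U)
subset-of-size-between []            []           zero    _   _         _         =
  [] , refl , ⊆-refl , ⊆-refl
subset-of-size-between (inside ∷ m)  (outside ∷ U) _      m⊆U _         _         with () ← m⊆U here
subset-of-size-between (outside ∷ m) (outside ∷ U) k      m⊆U m≤k       k≤U
  with S , ∣S∣≡k , m⊆S , S⊆U ← subset-of-size-between m U k (drop-∷-⊆ m⊆U) m≤k k≤U =
  outside ∷ S , ∣S∣≡k , s⊆s m⊆S , s⊆s S⊆U
subset-of-size-between (inside ∷ m)  (inside ∷ U)  (suc k) m⊆U (s≤s m≤k) (s≤s k≤U)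
  with S , ∣S∣≡k , m⊆S , S⊆U ← subset-of-size-between m U k (drop-∷-⊆ m⊆U) m≤k k≤U =
  inside ∷ S , cong suc ∣S∣≡k , s⊆s m⊆S , s⊆s S⊆U
subset-of-size-between (outside ∷ m) (inside ∷ U)  k      m⊆U m≤k       k≤1+U with k ℕ.≤? ∣ U ∣
... | yes k≤U with S , ∣S∣≡k , m⊆S , S⊆U ← subset-of-size-between m U k (drop-∷-⊆ m⊆U) m≤k k≤U =
  outside ∷ S , ∣S∣≡k , s⊆s m⊆S , out⊆ S⊆U
... | no k≰U =
  inside ∷ U , ℕ.≤-antisym (ℕ.≰⇒> k≰U) k≤1+U , out⊆ (drop-∷-⊆ m⊆U) , ⊆-refl

fromList : List (Fin n) → Subset n
fromList []ₗ       = ⊥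
fromList (v ∷ₗ vs) = ⁅ v ⁆ ∪ fromList vs

∣fromList∣≤length : (vs : List (Fin n)) → ∣ fromList vs ∣ ≤ length vs
∣fromList∣≤length {n} []ₗ   = ℕ.≤-reflexive (∣⊥∣≡0 n)
∣fromList∣≤length (v ∷ₗ vs) = begin
  ∣ ⁅ v ⁆ ∪ fromList vs ∣        ≤⟨ ∣p∪q∣≤∣p∣+∣q∣ ⁅ v ⁆ (fromList vs) ⟩
  ∣ ⁅ v ⁆ ∣ + ∣ fromList vs ∣    ≡⟨ cong (_+ ∣ fromList vs ∣) (∣⁅x⁆∣≡1 v) ⟩
  suc ∣ fromList vs ∣            ≤⟨ s≤s (∣fromList∣≤length vs) ⟩
  suc (length vs)                ∎
  where open ℕ.≤-Reasoning

∈-fromList⁺ : {v : Fin n} {vs : List (Fin n)} → v ∈ₗ vs → v ∈ₛ fromList vs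
∈-fromList⁺ {v = v} (Any.here refl) = x∈p∪q⁺ (inj₁ (x∈⁅x⁆ v))
∈-fromList⁺ {vs = w ∷ₗ _} (Any.there v∈vs) = x∈p∪q⁺ {p = ⁅ w ⁆} (inj₂ (∈-fromList⁺ v∈vs))

∈-fromList⁻ : {v : Fin n} (vs : List (Fin n)) → v ∈ₛ fromList vs → v ∈ₗ vs
∈-fromList⁻ []ₗ        v∈⊥ = contradiction v∈⊥ ∉⊥
∈-fromList⁻ (w ∷ₗ vs) v∈ with x∈p∪q⁻ ⁅ w ⁆ (fromList vs) v∈
... | inj₁ v∈⁅w⁆ = Any.here (x∈⁅y⁆⇒x≡y w v∈⁅w⁆)
... | inj₂ v∈vs  = Any.there (∈-fromList⁻ vs v∈vs)

fromList⊆∁⁅⁆ : {e : Fin n} {vs : List (Fin n)} → All (e ≢_) vs → fromList vs ⊆ ∁ ⁅ e ⁆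
fromList⊆∁⁅⁆ {e = e} {vs} e∉vs v∈ = x∉p⇒x∈∁p λ v∈⁅e⁆ →
  All.lookup e∉vs (∈-fromList⁻ vs v∈) (sym (x∈⁅y⁆⇒x≡y e v∈⁅e⁆))

∣∁⁅x⁆∣≡n∸1 : (x : Fin n) → ∣ ∁ ⁅ x ⁆ ∣ ≡ n ∸ 1
∣∁⁅x⁆∣≡n∸1 {n} x = trans (∣∁p∣≡n∸∣p∣ ⁅ x ⁆) (cong (n ∸_) (∣⁅x⁆∣≡1 x))

precedes-total : {t : Vec (Fin n) k} {x y : Fin n} → x ∈ t → y ∈ t → x ≢ y →
                 Precedes x y t ⊎ Precedes y x t
precedes-total {t = t} {x} {y} x∈t y∈t x≢y with Fin.<-cmp (VecAny.index x∈t) (VecAny.index y∈t)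
... | tri< i<j _ _ = inj₁ (_ , _ , i<j , sym (lookup-index x∈t) , sym (lookup-index y∈t))
... | tri> _ _ j<i = inj₂ (_ , _ , j<i , sym (lookup-index y∈t) , sym (lookup-index x∈t))
... | tri≈ _ i≡j _ = contradiction x≡y x≢y
  where
    open ≡-Reasoning
    x≡y : x ≡ y
    x≡y = begin
      x                           ≡⟨ lookup-index x∈t ⟩
      lookup t (VecAny.index x∈t) ≡⟨ cong (lookup t) i≡j ⟩
      lookup t (VecAny.index y∈t) ≡⟨ lookup-index y∈t ⟨
      y                           ∎

Precedes⇒∈ˡ : {t : Vec (Fin n) k} {x y : Fin n} → Precedes x y t → x ∈ t
Precedes⇒∈ˡ {t = t} (i , _ , _ , tᵢ≡x , _) = subst (_∈ t) tᵢ≡x (∈-lookup i t)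

Precedes⇒∈ʳ : {t : Vec (Fin n) k} {x y : Fin n} → Precedes x y t → y ∈ t
Precedes⇒∈ʳ {t = t} (_ , j , _ , _ , tⱼ≡y) = subst (_∈ t) tⱼ≡y (∈-lookup j t)

Precedes⇒≢ : {x y : Fin n} (t : Vec (Fin n) k) → Distinct t → Precedes x y t → x ≢ y
Precedes⇒≢ _ distinct (i , j , i<j , tᵢ≡x , tⱼ≡y) refl =
  Fin.<-irrefl (distinct i j (trans tᵢ≡x (sym tⱼ≡y))) i<j

distinct₂ : {a b : A} → a ≢ b → Distinct (a ∷ b ∷ [])
distinct₂ a≢b fzero        fzero        _ = refl
distinct₂ a≢b fzero        (fsuc fzero) e = contradiction e a≢b
distinct₂ a≢b (fsuc fzero) fzero        e = contradiction (sym e) a≢b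
distinct₂ a≢b (fsuc fzero) (fsuc fzero) _ = refl

distinct₃ : {a b c : A} → a ≢ b → a ≢ c → b ≢ c → Distinct (a ∷ b ∷ c ∷ [])
distinct₃ a≢b a≢c b≢c fzero               fzero               _ = refl
distinct₃ a≢b a≢c b≢c fzero               (fsuc fzero)        e = contradiction e a≢b
distinct₃ a≢b a≢c b≢c fzero               (fsuc (fsuc fzero)) e = contradiction e a≢c
distinct₃ a≢b a≢c b≢c (fsuc fzero)        fzero               e = contradiction (sym e) a≢b
distinct₃ a≢b a≢c b≢c (fsuc fzero)        (fsuc fzero)        _ = refl
distinct₃ a≢b a≢c b≢c (fsuc fzero)        (fsuc (fsuc fzero)) e = contradiction e b≢c
distinct₃ a≢b a≢c b≢c (fsuc (fsuc fzero)) fzero               e = contradiction (sym e) a≢c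
distinct₃ a≢b a≢c b≢c (fsuc (fsuc fzero)) (fsuc fzero)        e = contradiction (sym e) b≢c
distinct₃ a≢b a≢c b≢c (fsuc (fsuc fzero)) (fsuc (fsuc fzero)) _ = refl

C₁₂-sym : {T : HyperTournament n k} {x y : Fin n} → C₁₂ T x y → C₁₂ T y x
C₁₂-sym (z , z≢x , z≢y , P , Q , y∉P , x∉Q , lengths , disjoint) =
  z , z≢y , z≢x , Q , P , x∉Q , y∉P , swap lengths , λ i j → disjoint j i ∘ sym

C₁₂⇒≢ : {T : HyperTournament n k} {x y : Fin n} → C₁₂ T x y → x ≢ y
C₁₂⇒≢ (_ , _ , _ , P , _ , y∉P , _) x≡y = y∉P (fzero , trans (head-lookup (verts P)) (trans (start P) x≡y))
  where
    head-lookup : ∀ {m} (v : Vec A (suc m)) → lookup v fzero ≡ head v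
    head-lookup (_ ∷ _) = refl

module _ {n k} (T : HyperTournament n k) where
  open HyperTournament T

  arc-through-avoiding : k ≤ n ∸ 1 → {e : Fin n} (vs : List (Fin n)) → length vs ≤ k →
                         All (e ≢_) vs → ∃[ t ] (Arc t × All (_∈ t) vs × e ∉ t)
  arc-through-avoiding k≤n-1 {e} vs vs≤k e∉vs
    with S , ∣S∣≡k , vs⊆S , S⊆∁e ← subset-of-size-between (fromList vs) (∁ ⁅ e ⁆) k (fromList⊆∁⁅⁆ e∉vs)
                                      (ℕ.≤-trans (∣fromList∣≤length vs) vs≤k)
                                      (subst (k ≤_) (sym (∣∁⁅x⁆∣≡n∸1 e)) k≤n-1)
    with t , arc , t≈S ← arc-exists S ∣S∣≡k =
    t , arc , All.tabulate (λ v∈vs → Equivalence.from (t≈S _) (vs⊆S (∈-fromList⁺ v∈vs))) ,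
    λ e∈t → x∈∁p⇒x∉p (S⊆∁e (Equivalence.to (t≈S e) e∈t)) (x∈⁅x⁆ e)

  path₁ : {x z : Fin n} {α : Vec (Fin n) k} → Arc α → Precedes x z α → Path T x z
  path₁ {x} {z} {α} α-arc x≺z = record
    { len = 1 ; verts = x ∷ z ∷ [] ; arcs = α ∷ [] ; start = refl ; end = refl
    ; verts-dis = distinct₂ (Precedes⇒≢ α (arc-distinct α α-arc) x≺z)
    ; arcs-dis = λ { fzero fzero _ → refl }
    ; arcs-in = λ { fzero → α-arc } ; steps = λ { fzero → x≺z } }

  path₂ : {x u z : Fin n} {α β : Vec (Fin n) k} → Arc α → Arc β →
          Precedes x u α → Precedes u z β → x ≢ z → α ≢ β → Path T x z
  path₂ {x} {u} {z} {α} {β} α-arc β-arc x≺u u≺z x≢z α≢β = record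
    { len = 2 ; verts = x ∷ u ∷ z ∷ [] ; arcs = α ∷ β ∷ [] ; start = refl ; end = refl
    ; verts-dis = distinct₃ (Precedes⇒≢ α (arc-distinct α α-arc) x≺u) x≢z
                            (Precedes⇒≢ β (arc-distinct β β-arc) u≺z)
    ; arcs-dis = distinct₂ α≢β
    ; arcs-in = λ { fzero → α-arc ; (fsuc fzero) → β-arc }
    ; steps = λ { fzero → x≺u ; (fsuc fzero) → u≺z } }

  ∉V : {x z y : Fin n} (P : Path T x z) → VecAll.All (y ≢_) (verts P) → ¬ y ∈V P
  ∉V P y∉P (i , Pᵢ≡y) = VecAll.lookup y∉P (subst (_∈ verts P) Pᵢ≡y (∈-lookup i (verts P))) refl

  C₁₂-common-prey : {x y z : Fin n} {α β : Vec (Fin n) k} → Arc α → Arc β →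
                    Precedes x z α → Precedes y z β → α ≢ β → x ≢ y → C₁₂ T x y
  C₁₂-common-prey {x} {y} {z} {α} {β} α-arc β-arc x≺z y≺z α≢β x≢y =
    z , ≢-sym x≢z , ≢-sym y≢z , path₁ α-arc x≺z , path₁ β-arc y≺z ,
    ∉V (path₁ α-arc x≺z) (≢-sym x≢y VecAll.∷ y≢z VecAll.∷ VecAll.[]) ,
    ∉V (path₁ β-arc y≺z) (x≢y VecAll.∷ x≢z VecAll.∷ VecAll.[]) ,
    inj₁ (s≤s z≤n , s≤s z≤n) , λ { fzero fzero → α≢β }
    where
      x≢z = Precedes⇒≢ α (arc-distinct α α-arc) x≺z
      y≢z = Precedes⇒≢ β (arc-distinct β β-arc) y≺z

  C₁₂-via-two-step : {x u z y : Fin n} {α β γ : Vec (Fin n) k} → Arc α → Arc β → Arc γ →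
                     Precedes x u α → Precedes u z β → Precedes y z γ →
                     x ≢ z → x ≢ y → u ≢ y → α ≢ β → γ ≢ α → γ ≢ β → C₁₂ T x y
  C₁₂-via-two-step {x} {u} {z} {y} {α} {β} {γ} α-arc β-arc γ-arc x≺u u≺z y≺z x≢z x≢y u≢y α≢β γ≢α γ≢β =
    z , ≢-sym x≢z , ≢-sym y≢z , P , Q ,
    ∉V P (≢-sym x≢y VecAll.∷ ≢-sym u≢y VecAll.∷ y≢z VecAll.∷ VecAll.[]) ,
    ∉V Q (x≢y VecAll.∷ x≢z VecAll.∷ VecAll.[]) ,
    inj₂ (s≤s z≤n , s≤s (s≤s z≤n)) ,
    λ { fzero fzero → γ≢α ∘ sym ; (fsuc fzero) fzero → γ≢β ∘ sym }
    where
      y≢z = Precedes⇒≢ γ (arc-distinct γ γ-arc) y≺z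
      P = path₂ α-arc β-arc x≺u u≺z x≢z α≢β
      Q = path₁ γ-arc y≺z

  adjacent-to-one-of : 3 ≤ k → k ≤ n ∸ 1 → {c z y₁ y₂ : Fin n} (α : Vec (Fin n) k) →
                       Arc α → Precedes c z α → y₁ ≢ y₂ → c ≢ y₁ → c ≢ y₂ → z ≢ y₁ → z ≢ y₂ →
                       C₁₂ T c y₁ ⊎ C₁₂ T c y₂
  adjacent-to-one-of 3≤k k≤n-1 {c} {z} {y₁} {y₂} α α-arc c≺z y₁≢y₂ c≢y₁ c≢y₂ z≢y₁ z≢y₂
    with β , β-arc , z∈β ∷ₐ y₁∈β ∷ₐ y₂∈β ∷ₐ []ₐ , c∉β
           ← arc-through-avoiding k≤n-1 (z ∷ₗ y₁ ∷ₗ y₂ ∷ₗ []ₗ) 3≤k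
               (Precedes⇒≢ α (arc-distinct α α-arc) c≺z ∷ₐ c≢y₁ ∷ₐ c≢y₂ ∷ₐ []ₐ)
       | γ , γ-arc , y₁∈γ ∷ₐ y₂∈γ ∷ₐ []ₐ , z∉γ
           ← arc-through-avoiding k≤n-1 (y₁ ∷ₗ y₂ ∷ₗ []ₗ) (ℕ.<⇒≤ 3≤k) (z≢y₁ ∷ₐ z≢y₂ ∷ₐ []ₐ)
    = by-cases (precedes-total y₁∈β z∈β (≢-sym z≢y₁)) (precedes-total y₂∈β z∈β (≢-sym z≢y₂))
               (precedes-total y₁∈γ y₂∈γ y₁≢y₂)
    where
      α≢β : α ≢ β
      α≢β refl = c∉β (Precedes⇒∈ˡ c≺z)
      γ≢α : γ ≢ α
      γ≢α refl = z∉γ (Precedes⇒∈ʳ c≺z)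
      γ≢β : γ ≢ β
      γ≢β refl = z∉γ z∈β
      by-cases : Precedes y₁ z β ⊎ Precedes z y₁ β → Precedes y₂ z β ⊎ Precedes z y₂ β →
                 Precedes y₁ y₂ γ ⊎ Precedes y₂ y₁ γ → C₁₂ T c y₁ ⊎ C₁₂ T c y₂
      by-cases (inj₁ y₁≺z) _           _ = inj₁ (C₁₂-common-prey α-arc β-arc c≺z y₁≺z α≢β c≢y₁)
      by-cases (inj₂ _)    (inj₁ y₂≺z) _ = inj₂ (C₁₂-common-prey α-arc β-arc c≺z y₂≺z α≢β c≢y₂)
      by-cases (inj₂ _)    (inj₂ z≺y₂) (inj₁ y₁≺y₂) =
        inj₁ (C₁₂-via-two-step α-arc β-arc γ-arc c≺z z≺y₂ y₁≺y₂ c≢y₂ c≢y₁ z≢y₁ α≢β γ≢α γ≢β)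
      by-cases (inj₂ z≺y₁) (inj₂ _)    (inj₂ y₂≺y₁) =
        inj₂ (C₁₂-via-two-step α-arc β-arc γ-arc c≺z z≺y₁ y₂≺y₁ c≢y₁ c≢y₂ z≢y₂ α≢β γ≢α γ≢β)

  Sink : Fin n → Set
  Sink c = ∀ {w} t → Arc t → ¬ Precedes c w t

  three-non-neighbours⇒Sink : 3 ≤ k → k ≤ n ∸ 1 → {c a b d : Fin n} →
                              c ≢ a → c ≢ b → c ≢ d → a ≢ b → a ≢ d → b ≢ d →
                              ¬ C₁₂ T c a → ¬ C₁₂ T c b → ¬ C₁₂ T c d → Sink c
  three-non-neighbours⇒Sink 3≤k k≤n-1 {c} {a} {b} {d} c≢a c≢b c≢d a≢b a≢d b≢d ¬ca ¬cb ¬cd {w} t t-arc c≺w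
    with w ≟ a | w ≟ b
  ... | yes refl | _        = [ ¬cb , ¬cd ] (adjacent-to-one-of 3≤k k≤n-1 t t-arc c≺w b≢d c≢b c≢d a≢b a≢d)
  ... | no w≢a   | yes refl = [ ¬ca , ¬cd ] (adjacent-to-one-of 3≤k k≤n-1 t t-arc c≺w a≢d c≢a c≢d (≢-sym a≢b) b≢d)
  ... | no w≢a   | no w≢b   = [ ¬ca , ¬cb ] (adjacent-to-one-of 3≤k k≤n-1 t t-arc c≺w a≢b c≢a c≢b w≢a w≢b)

  module _ {c : Fin n} (sink : Sink c) where

    Sink⇒path-trivial : {z : Fin n} → Path T c z → z ≡ c
    Sink⇒path-trivial record { len = zero ; verts = _ ∷ [] ; start = v≡c ; end = v≡z } =
      trans (sym v≡z) v≡c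
    Sink⇒path-trivial record { len = suc _ ; verts = _ ∷ _ ∷ _ ; arcs = α ∷ _
                             ; start = refl ; arcs-in = arcs-in ; steps = steps } =
      contradiction (steps fzero) (sink α (arcs-in fzero))

    Sink⇒¬C₁₂ : {y : Fin n} → ¬ C₁₂ T c y
    Sink⇒¬C₁₂ (_ , z≢c , _ , P , _) = z≢c (Sink⇒path-trivial P)

    Sink⇒Precedes : {x : Fin n} {t : Vec (Fin n) k} → Arc t → x ∈ t → c ∈ t → x ≢ c →
                    Precedes x c t
    Sink⇒Precedes {t = t} t-arc x∈t c∈t x≢c =
      [ id , (λ c≺x → contradiction c≺x (sink t t-arc)) ] (precedes-total x∈t c∈t x≢c)

    Sink⇒C₁₂ : 2 ≤ k → k ≤ n ∸ 1 → {x y : Fin n} → x ≢ y → x ≢ c → y ≢ c → C₁₂ T x y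
    Sink⇒C₁₂ 2≤k k≤n-1 {x} {y} x≢y x≢c y≢c
      with α , α-arc , x∈α ∷ₐ c∈α ∷ₐ []ₐ , y∉α
             ← arc-through-avoiding k≤n-1 (x ∷ₗ c ∷ₗ []ₗ) 2≤k (≢-sym x≢y ∷ₐ y≢c ∷ₐ []ₐ)
         | β , β-arc , y∈β ∷ₐ c∈β ∷ₐ []ₐ , _
             ← arc-through-avoiding k≤n-1 (y ∷ₗ c ∷ₗ []ₗ) 2≤k (x≢y ∷ₐ x≢c ∷ₐ []ₐ)
      = C₁₂-common-prey α-arc β-arc (Sink⇒Precedes α-arc x∈α c∈α x≢c)
          (Sink⇒Precedes β-arc y∈β c∈β y≢c) (λ { refl → y∉α y∈β }) x≢y

    Sink⇒IsKn-1∪K1 : 2 ≤ k → k ≤ n ∸ 1 → IsKn-1∪K1 (C₁₂ T)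
    Sink⇒IsKn-1∪K1 2≤k k≤n-1 = c , λ x y → mk⇔
      (λ xy → C₁₂⇒≢ xy , (λ { refl → Sink⇒¬C₁₂ xy }) , (λ { refl → Sink⇒¬C₁₂ (C₁₂-sym xy) }))
      (λ (x≢y , x≢c , y≢c) → Sink⇒C₁₂ 2≤k k≤n-1 x≢y x≢c y≢c)

lemma3p3 : (n k : ℕ) → 3 ≤ k → k ≤ n ∸ 1 → (T : HyperTournament n k) →
    ¬ IsKn-1∪K1 (C₁₂ T) → ¬ ContainsK13 (Complement (C₁₂ T))
lemma3p3 n k 3≤k k≤n-1 T ¬K
         (c , a , b , d , c≢a , c≢b , c≢d , a≢b , a≢d , b≢d , (_ , ¬ca) , (_ , ¬cb) , (_ , ¬cd)) =
  ¬K (Sink⇒IsKn-1∪K1 T sink (ℕ.<⇒≤ 3≤k) k≤n-1)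
  where
    sink : Sink T c
    sink = three-non-neighbours⇒Sink T 3≤k k≤n-1 c≢a c≢b c≢d a≢b a≢d b≢d ¬ca ¬cb ¬cd
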